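{- Let $n$ be a positive integer. If $l_2(n)=2^{k+1}s+\frac{1-(-2)^k}{3}$ for some nonnegative integer $k$ and integer $s$, then $l_2(n+1)=3^{k+1}s+\frac{1-(-3)^k}{2}$.
   Context: The triangle $T_m$ (rotation number $m$) is the array whose row $x$ ($x=1,2,\dots$) has $x$ entries in columns $0,\dots,x-1$, defined by $T_m(1,0)=1$; for $x>1$ and $0\le c\le x-2$, $T_m(x,c)=T_m(x-1,c+m)$; and $T_m(x,x-1)=1+T_m(x-1,0)$, where $T_m(x,c)$ for any integer $c$ denotes the entry in row $x$, column ($c$ mod $x$). Define $l_2(1)=1$ and $l_2(n)=\min\{x>l_2(n-1): T_2(x,0)=1\}$ for $n\ge2$, i.e. $l_2(n)$ is the $n$th row of $T_2$ headed by $1$. -}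

module Defs where

open import Data.Nat using (ℕ; zero; suc; _+_; _≤ᵇ_; _<_; _%_)
open import Data.Bool using (if_then_else_)
open import Relation.Binary.PropositionalEquality using (_≡_; _≢_)

-- Tr m r c = T_m(r+1, c), the entry in row x = r+1, column (c mod x).
Tr : ℕ → ℕ → ℕ → ℕ
Tr m zero    c = 1
Tr m (suc r) c =
  let c' = c % suc (suc r) in
  if c' ≤ᵇ r then Tr m r ((c' + m) % suc r) else suc (Tr m r 0)

-- T m x c = T_m(x, c) for rows x ≥ 1 (row 0 does not exist; value is junk).
T : ℕ → ℕ → ℕ → ℕ
T m zero    c = 0
T m (suc r) c = Tr m r c

-- L2 n x  means  l₂(n) = x  (graph of the recursively defined l₂).
data L2 : ℕ → ℕ → Set where
  l2-one  : L2 1 1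
  l2-next : ∀ {n y x} → L2 n y → y < x → T 2 x 0 ≡ 1
          → (∀ z → y < z → z < x → T 2 z 0 ≢ 1)
          → L2 (suc n) x

-- Index the rows of T₂ from 0, so that row r has r + 1 entries.  Each row contains a single 1,
-- and passing to the next row moves it two columns to the left, cyclically; call row r a head if
-- its 1 is in column 0.  After a head at r = 1 + 2s the 1 walks back to column 0 in s steps, so
-- the next head is 2 + 3s.  After a head at r = 2v the 1 reaches the second-to-last column at
-- r = 1 + 3v; from the second-to-last column of row 2m it returns to the second-to-last column
-- at row 3m, and from that of row 1 + 2u it reaches column 0 at row 1 + 3u.  Hence if
-- 1 + 3v = 2ʲw and 3ʲw = 1 + 2u, the head following 2v is 1 + 3u.  For k = j + 1 the closed forms
-- of the statement produce such v, w and u, using (1 − (−2)ᵏ)/3 = Σ_{i<k} (−2)ⁱ and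
-- (1 − (−3)ᵏ)/2 = 2 Σ_{i<k} (−3)ⁱ; the case k = 0, where l₂(n) = 2s, is the first one above.

module Submission where

open import Defs
open import Data.Nat using (ℕ; suc; _≥_)
open import Data.Product using (Σ; _×_; _,_)
open import Relation.Binary.PropositionalEquality using (_≡_; refl; subst)

module T₂Columns where
  open import Data.Bool using (true; false)
  open import Data.Empty using (⊥-elim)
  open import Data.List using (_∷_; [])
  open import Data.Nat
  open import Data.Nat.DivMod using (m<n⇒m%n≡m; n%n≡0; [m+n]%n≡m%n; m%n<n)
  open import Data.Nat.Properties
  open import Algebra.Properties.CommutativeSemigroup *-commutativeSemigroup using (x∙yz≈y∙xz)
  open import Data.Nat.Tactic.RingSolver using (solve)
  open import Data.Sum using (inj₁; inj₂)
  open import Data.Unit using (tt)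
  open import Function using (_∘_; _⇔_; mk⇔; Equivalence)
  open import Relation.Binary.PropositionalEquality
  open import Relation.Nullary using (¬_; yes; no)

  Tr-suc-≤ : ∀ m {r c} → c ≤ r → Tr m (suc r) c ≡ Tr m r ((c + m) % suc r)
  Tr-suc-≤ m {r} {c} c≤r rewrite m<n⇒m%n≡m {n = suc (suc r)} (s≤s (m≤n⇒m≤1+n c≤r))
    with c ≤ᵇ r | ≤⇒≤ᵇ c≤r
  ... | true | _ = refl

  Tr-suc-last : ∀ m r → Tr m (suc r) (suc r) ≡ suc (Tr m r 0)
  Tr-suc-last m r rewrite m<n⇒m%n≡m {n = suc (suc r)} ≤-refl
    with suc r ≤ᵇ r | ≤ᵇ⇒≤ (suc r) r
  ... | true  | 1+r≤r = ⊥-elim (1+n≰n (1+r≤r tt))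
  ... | false | _     = refl

  Tr≢0 : ∀ m r c → Tr m r c ≢ 0
  Tr≢0 m zero    c ()
  Tr≢0 m (suc r) c with c % suc (suc r) ≤ᵇ r
  ... | true  = Tr≢0 m r _
  ... | false = λ ()

  rotate : ℕ → ℕ → ℕ
  rotate r c = (2 + c) % suc r

  -- unrotate r a is the column c ≤ r with rotate r c ≡ a, i.e. the column of row r + 1 that the
  -- recursion for T₂ sends to column a of row r.
  unrotate : ℕ → ℕ → ℕ
  unrotate r zero          = r ∸ 1
  unrotate r (suc zero)    = r
  unrotate r (suc (suc a)) = a

  unrotate≤ : ∀ {r a} → a ≤ r → unrotate r a ≤ r
  unrotate≤ {r} {zero}        _ = m∸n≤m r 1
  unrotate≤ {r} {suc zero}    _ = ≤-refl
  unrotate≤ {r} {suc (suc a)} h = m+n≤o⇒n≤o 2 h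

  rotate-unrotate : ∀ {r a} → a ≤ r → rotate r (unrotate r a) ≡ a
  rotate-unrotate {zero}  {zero}        _ = refl
  rotate-unrotate {suc r} {zero}        _ = n%n≡0 (2 + r)
  rotate-unrotate {suc r} {suc zero}    _ = [m+n]%n≡m%n 1 (2 + r)
  rotate-unrotate {r}     {suc (suc a)} h = m<n⇒m%n≡m (s≤s h)

  unrotate-rotate : ∀ {r c} → c ≤ r → unrotate r (rotate r c) ≡ c
  unrotate-rotate {r} {c} c≤r =
    subst (λ r → unrotate r (rotate r c) ≡ c) (m∸n+n≡m c≤r) (offset (r ∸ c) c)
    where
    offset : ∀ o c → unrotate (o + c) (rotate (o + c) c) ≡ c
    offset zero          zero    = refl
    offset zero          (suc c) = cong (unrotate (suc c)) ([m+n]%n≡m%n 1 (2 + c))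
    offset (suc zero)    c       = cong (unrotate (suc c)) (n%n≡0 (2 + c))
    offset (suc (suc o)) c       =
      cong (unrotate (2 + o + c)) (m<n⇒m%n≡m (s≤s (s≤s (s≤s (m≤n+m c o)))))

  oneColumn : ℕ → ℕ
  oneColumn zero    = 0
  oneColumn (suc r) = unrotate r (oneColumn r)

  oneColumn≤ : ∀ r → oneColumn r ≤ r
  oneColumn≤ zero    = z≤n
  oneColumn≤ (suc r) = m≤n⇒m≤1+n (unrotate≤ (oneColumn≤ r))

  Tr₂≡1⇔ : ∀ {r c} → c ≤ r → Tr 2 r c ≡ 1 ⇔ c ≡ oneColumn r
  Tr₂≡1⇔ {zero}  z≤n = mk⇔ (λ _ → refl) (λ _ → refl)
  Tr₂≡1⇔ {suc r} {c} c≤1+r with m≤n⇒m<n∨m≡n c≤1+r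
  ... | inj₁ (s≤s c≤r) rewrite Tr-suc-≤ 2 c≤r | +-comm c 2 = mk⇔
    (λ e → trans (sym (unrotate-rotate c≤r)) (cong (unrotate r) (IH.to e)))
    (λ e → IH.from (trans (cong (rotate r) e) (rotate-unrotate (oneColumn≤ r))))
    where module IH = Equivalence (Tr₂≡1⇔ {r} (≤-pred (m%n<n (2 + c) (suc r))))
  ... | inj₂ refl rewrite Tr-suc-last 2 r = mk⇔
    (λ e → ⊥-elim (Tr≢0 2 r 0 (suc-injective e)))
    (λ e → ⊥-elim (1+n≰n (subst (_≤ r) (sym e) (unrotate≤ (oneColumn≤ r)))))

  Head : ℕ → Set
  Head r = oneColumn r ≡ 0

  HeadFree : ℕ → ℕ → Set
  HeadFree a b = ∀ {r} → a ≤ r → r < b → ¬ Head r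

  HeadFree-empty : ∀ a → HeadFree a a
  HeadFree-empty a a≤r r<a = ⊥-elim (<⇒≱ r<a a≤r)

  HeadFree-single : ∀ {a} → ¬ Head a → HeadFree a (suc a)
  HeadFree-single h a≤r (s≤s r≤a) = subst (¬_ ∘ Head) (≤-antisym a≤r r≤a) h

  HeadFree-trans : ∀ {a b c} → HeadFree a b → HeadFree b c → HeadFree a c
  HeadFree-trans {b = b} ab bc {r} a≤r r<c with r <? b
  ... | yes r<b = ab a≤r r<b
  ... | no  r≮b = bc (≮⇒≥ r≮b) r<c

  record Reaches (P : ℕ → Set) (a b : ℕ) : Set where
    constructor _,_
    field
      reached  : P b
      headFree : HeadFree a b

  open Reaches

  Reaches-trans : ∀ {P Q a b c} → Reaches Q a b → Reaches P b c → Reaches P a c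
  Reaches-trans (_ , ab) (p , bc) = p , HeadFree-trans ab bc

  SecondLast : ℕ → Set
  SecondLast r = suc (oneColumn r) ≡ r

  descend : ∀ t {r a} → oneColumn r ≡ a + 2 * t → Reaches (λ b → oneColumn b ≡ a) r (r + t)
  descend zero {r} {a} e rewrite +-identityʳ r | +-identityʳ a = e , HeadFree-empty r
  descend (suc t) {r} {a} e rewrite +-suc r t =
    reached rest ,
    HeadFree-trans (HeadFree-single (λ e′ → 0≢1+n (trans (sym e′) e″))) (headFree rest)
    where
    e″ : oneColumn r ≡ 2 + (a + 2 * t)
    e″ = trans e (solve (a ∷ t ∷ []))
    rest : Reaches (λ b → oneColumn b ≡ a) (suc r) (suc r + t)
    rest = descend t (cong (unrotate r) e″)

  odd-column : ∀ u {r} → oneColumn r ≡ 1 + 2 * u → Reaches SecondLast r (suc (r + u))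
  odd-column u {r} e with descend u {a = 1} e
  ... | reachOne , between =
    cong (suc ∘ unrotate (r + u)) reachOne ,
    HeadFree-trans between (HeadFree-single (λ e′ → 1+n≢0 (trans (sym reachOne) e′)))

  head-odd : ∀ s → Head (1 + 2 * s) → Reaches Head (2 + 2 * s) (2 + 3 * s)
  head-odd s h =
    subst (Reaches Head (2 + 2 * s)) eq (descend s {a = 0} (cong (unrotate (1 + 2 * s)) h))
    where
    eq : 2 + 2 * s + s ≡ 2 + 3 * s
    eq = solve (s ∷ [])

  head-even : ∀ v → Head (2 * v) → Reaches SecondLast (1 + 2 * v) (1 + 3 * v)
  head-even zero    _ = refl , HeadFree-empty 1
  head-even (suc v) h =
    subst₂ (Reaches SecondLast) start end
      (odd-column v (cong (unrotate (2 + 2 * v)) (subst Head row h)))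
    where
    row : 2 * suc v ≡ 2 + 2 * v
    row = solve (v ∷ [])
    start : 3 + 2 * v ≡ 1 + 2 * suc v
    start = solve (v ∷ [])
    end : suc (3 + 2 * v + v) ≡ 1 + 3 * suc v
    end = solve (v ∷ [])

  secondLast-even : ∀ m → SecondLast (2 * m) → Reaches SecondLast (2 * m) (3 * m)
  secondLast-even zero    ()
  secondLast-even (suc u) h =
    subst (Reaches SecondLast (2 * suc u)) end (odd-column u (suc-injective (trans h row)))
    where
    row : 2 * suc u ≡ suc (1 + 2 * u)
    row = solve (u ∷ [])
    end : suc (2 * suc u + u) ≡ 3 * suc u
    end = solve (u ∷ [])

  secondLast-odd : ∀ u → SecondLast (1 + 2 * u) → Reaches Head (1 + 2 * u) (1 + 3 * u)
  secondLast-odd u h = subst (Reaches Head (1 + 2 * u)) end (descend u {a = 0} (suc-injective h))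
    where
    end : 1 + 2 * u + u ≡ 1 + 3 * u
    end = solve (u ∷ [])

  secondLast-pow : ∀ j m → SecondLast (2 ^ j * m) → Reaches SecondLast (2 ^ j * m) (3 ^ j * m)
  secondLast-pow zero    m h = h , HeadFree-empty _
  secondLast-pow (suc j) m h =
    Reaches-trans tripled
      (subst (Reaches SecondLast (2 ^ j * (3 * m))) end (secondLast-pow j (3 * m) (reached tripled)))
    where
    tripled : Reaches SecondLast (2 ^ suc j * m) (2 ^ j * (3 * m))
    tripled = subst₂ (Reaches SecondLast) (sym (*-assoc 2 (2 ^ j) m)) (x∙yz≈y∙xz 3 (2 ^ j) m)
      (secondLast-even (2 ^ j * m) (subst SecondLast (*-assoc 2 (2 ^ j) m) h))
    end : 3 ^ j * (3 * m) ≡ 3 ^ suc j * m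
    end = trans (x∙yz≈y∙xz (3 ^ j) 3 m) (sym (*-assoc 3 (3 ^ j) m))

  T₂-first≡1⇔Head : ∀ r → T 2 (suc r) 0 ≡ 1 ⇔ Head r
  T₂-first≡1⇔Head r = mk⇔ (sym ∘ to) (from ∘ sym)
    where open Equivalence (Tr₂≡1⇔ {r} z≤n)

  L2⇒T₂≡1 : ∀ {n x} → L2 n x → T 2 x 0 ≡ 1
  L2⇒T₂≡1 l2-one               = refl
  L2⇒T₂≡1 (l2-next _ _ head _) = head

  L2⇒≢0 : ∀ {n x} → L2 n x → x ≢ 0
  L2⇒≢0 l refl = 0≢1+n (L2⇒T₂≡1 l)

  L2-next-head : ∀ {n r r′} → L2 n (suc r) → r < r′ → Reaches Head (suc r) r′
               → L2 (suc n) (suc r′)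
  L2-next-head {r = r} {r′} l r<r′ (head , gap) =
    l2-next l (s≤s r<r′) (Equivalence.from (T₂-first≡1⇔Head r′) head) noHead
    where
    noHead : ∀ z → suc r < z → z < suc r′ → T 2 z 0 ≢ 1
    noHead (suc z) (s≤s r<z) (s≤s z<r′) T₂≡1 =
      gap r<z z<r′ (Equivalence.to (T₂-first≡1⇔Head z) T₂≡1)

  L2-even : ∀ {n} s → L2 n (2 * suc s) → L2 (suc n) (3 * suc s)
  L2-even {n} s l =
    subst (L2 (suc n)) end (L2-next-head (subst (L2 n) start l) before (head-odd s head))
    where
    start : 2 * suc s ≡ 2 + 2 * s
    start = solve (s ∷ [])
    end : 3 + 3 * s ≡ 3 * suc s
    end = solve (s ∷ [])
    before : 1 + 2 * s < 2 + 3 * s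
    before = s≤s (s≤s (*-monoˡ-≤ s (n≤1+n 2)))
    head : Head (1 + 2 * s)
    head = Equivalence.to (T₂-first≡1⇔Head (1 + 2 * s)) (L2⇒T₂≡1 (subst (L2 n) start l))

  L2-odd : ∀ {n} j v w u → L2 n (1 + 2 * v) → 1 + 3 * v ≡ 2 ^ j * w → 3 ^ j * w ≡ 1 + 2 * u
         → L2 (suc n) (2 + 3 * u)
  L2-odd j v w u l e₁ e₃ = L2-next-head l before
    (Reaches-trans toPower (Reaches-trans powers (secondLast-odd u (reached powers))))
    where
    head : Head (2 * v)
    head = Equivalence.to (T₂-first≡1⇔Head (2 * v)) (L2⇒T₂≡1 l)
    toPower : Reaches SecondLast (1 + 2 * v) (2 ^ j * w)
    toPower = subst (Reaches SecondLast (1 + 2 * v)) e₁ (head-even v head)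
    powers : Reaches SecondLast (2 ^ j * w) (1 + 2 * u)
    powers = subst (Reaches SecondLast (2 ^ j * w)) e₃ (secondLast-pow j w (reached toPower))
    3v≤2u : 3 * v ≤ 2 * u
    3v≤2u = ≤-pred (subst₂ _≤_ (sym e₁) e₃ (*-monoˡ-≤ w (^-monoˡ-≤ j (n≤1+n 2))))
    before : 2 * v < 1 + 3 * u
    before = s≤s (≤-trans (*-monoˡ-≤ v (n≤1+n 2)) (≤-trans 3v≤2u (*-monoˡ-≤ u (n≤1+n 2))))

module IntegerArithmetic where
  open import Data.Empty using (⊥-elim)
  open import Data.Product using (proj₁; proj₂)
  open import Function using (_∘_)
  open import Data.Integer using (ℤ; +_; -[1+_]; ∣_∣; 0ℤ; 1ℤ; -1ℤ; _+_; _-_; _*_; _^_; -_; _/ℕ_)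
  open import Data.Integer.DivMod using (_/_; div-pos-is-/ℕ)
  open import Data.List using (_∷_; [])
  open import Data.Integer.Properties using (pos-*; *-zeroʳ; *-assoc; +-injective; +-identityʳ)
  open import Data.Integer.Tactic.RingSolver using (solve; solve-∀)
  open import Data.Nat as ℕ using (ℕ; zero; suc)
  import Data.Nat.DivMod as ℕ
  import Data.Nat.Properties as ℕ
  open import Relation.Binary.PropositionalEquality
  open ≡-Reasoning

  geom : ℤ → ℕ → ℤ
  geom a zero    = 0ℤ
  geom a (suc k) = 1ℤ + a * geom a k

  geom-closed : ∀ a k → (1ℤ - a) * geom a k ≡ 1ℤ - a ^ k
  geom-closed a zero    = *-zeroʳ (1ℤ - a)
  geom-closed a (suc k) = begin
    (1ℤ - a) * (1ℤ + a * geom a k)      ≡⟨ expand a (geom a k) ⟩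
    1ℤ - a + a * ((1ℤ - a) * geom a k)  ≡⟨ cong (λ t → 1ℤ - a + a * t) (geom-closed a k) ⟩
    1ℤ - a + a * (1ℤ - a ^ k)           ≡⟨ collapse a (a ^ k) ⟩
    1ℤ - a * a ^ k                      ∎
    where
    expand : ∀ a g → (1ℤ - a) * (1ℤ + a * g) ≡ 1ℤ - a + a * ((1ℤ - a) * g)
    expand = solve-∀
    collapse : ∀ a A → 1ℤ - a + a * (1ℤ - A) ≡ 1ℤ - a * A
    collapse = solve-∀

  ^-distribʳ-* : ∀ i j n → (i * j) ^ n ≡ i ^ n * j ^ n
  ^-distribʳ-* i j zero    = refl
  ^-distribʳ-* i j (suc n) = begin
    i * j * (i * j) ^ n       ≡⟨ cong (i * j *_) (^-distribʳ-* i j n) ⟩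
    i * j * (i ^ n * j ^ n)   ≡⟨ interchange i j (i ^ n) (j ^ n) ⟩
    i * i ^ n * (j * j ^ n)   ∎
    where
    interchange : ∀ a b c d → a * b * (c * d) ≡ a * c * (b * d)
    interchange = solve-∀

  pos-^ : ∀ m n → (+ m) ^ n ≡ + (m ℕ.^ n)
  pos-^ m zero    = refl
  pos-^ m (suc n) = trans (cong (+ m *_) (pos-^ m n)) (sym (pos-* m (m ℕ.^ n)))

  [n*i]/n≡i : ∀ d i → (+ suc d * i) / + suc d ≡ i
  [n*i]/n≡i d i = trans (div-pos-is-/ℕ (+ suc d * i) (suc d)) (divℕ i)
    where
    divℕ : ∀ i → (+ suc d * i) /ℕ suc d ≡ i
    divℕ (+ n) = begin
      (+ suc d * + n) /ℕ suc d  ≡⟨ cong (_/ℕ suc d) (sym (pos-* (suc d) n)) ⟩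
      + (suc d ℕ.* n ℕ./ suc d) ≡⟨ cong (λ m → + (m ℕ./ suc d)) (ℕ.*-comm (suc d) n) ⟩
      + (n ℕ.* suc d ℕ./ suc d) ≡⟨ cong +_ (ℕ.m*n/n≡m n (suc d)) ⟩
      + n                       ∎
    divℕ -[1+ n ] with suc (n ℕ.+ d ℕ.* suc n) ℕ.% suc d in rem
    ... | zero  = cong (λ m → - (+ m))
      (trans (cong (ℕ._/ suc d) (ℕ.*-comm (suc d) (suc n))) (ℕ.m*n/n≡m (suc n) (suc d)))
    ... | suc r with () ← trans (sym rem)
      (trans (cong (ℕ._% suc d) (ℕ.*-comm (suc d) (suc n))) (ℕ.m*n%n≡0 (suc n) (suc d)))

  +n≡m*i⇒i≥0 : ∀ {n m i} → 0 ℕ.< m → + n ≡ + m * i → + ∣ i ∣ ≡ i × n ≡ m ℕ.* ∣ i ∣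
  +n≡m*i⇒i≥0 {n} {m} {+ k} _ e = refl , +-injective (trans e (sym (pos-* m k)))
  +n≡m*i⇒i≥0 {m = suc _} { -[1+ _ ]} (ℕ.s≤s _) ()

  +n≡1+2*i⇒i≥0 : ∀ {n i} → + n ≡ 1ℤ + + 2 * i → + ∣ i ∣ ≡ i × n ≡ 1 ℕ.+ 2 ℕ.* ∣ i ∣
  +n≡1+2*i⇒i≥0 {n} {+ k} e = refl , +-injective (trans e (cong (λ t → 1ℤ + t) (sym (pos-* 2 k))))
  +n≡1+2*i⇒i≥0 {n} { -[1+ k ]} e =
    ⊥-elim (+≢-[1+] (trans e (trans (negative (+ k)) (cong (λ t → - (1ℤ + t)) (sym (pos-* 2 k))))))
    where
    negative : ∀ K → 1ℤ + + 2 * - (1ℤ + K) ≡ - (1ℤ + + 2 * K)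
    negative = solve-∀
    +≢-[1+] : ∀ {m} → + n ≢ -[1+ m ]
    +≢-[1+] ()

  [1-[-2]^k]/3≡geom : ∀ k → (1ℤ - (- + 2) ^ k) / + 3 ≡ geom (- + 2) k
  [1-[-2]^k]/3≡geom k =
    trans (cong (_/ + 3) (sym (geom-closed (- + 2) k))) ([n*i]/n≡i 2 (geom (- + 2) k))

  [1-[-3]^k]/2≡2*geom : ∀ k → (1ℤ - (- + 3) ^ k) / + 2 ≡ + 2 * geom (- + 3) k
  [1-[-3]^k]/2≡2*geom k = trans
    (cong (_/ + 2) (trans (sym (geom-closed (- + 3) k)) (*-assoc (+ 2) (+ 2) (geom (- + 3) k))))
    ([n*i]/n≡i 1 (+ 2 * geom (- + 3) k))

  1+b[aAs-G]≡A[bas+E] : ∀ a b A E G s → b * G ≡ 1ℤ - A * E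
                      → 1ℤ + b * (a * A * s - G) ≡ A * (b * a * s + E)
  1+b[aAs-G]≡A[bas+E] a b A E G s bG≡1-AE = begin
    1ℤ + b * (a * A * s - G)            ≡⟨ solve (a ∷ b ∷ A ∷ G ∷ s ∷ []) ⟩
    b * a * A * s + (1ℤ - b * G)        ≡⟨ cong (λ t → b * a * A * s + (1ℤ - t)) bG≡1-AE ⟩
    b * a * A * s + (1ℤ - (1ℤ - A * E)) ≡⟨ solve (a ∷ b ∷ A ∷ E ∷ s ∷ []) ⟩
    A * (b * a * s + E)                 ∎

  V W U : ℕ → ℤ → ℤ
  V j s = + 2 * (+ 2) ^ j * s - geom (- + 2) j
  W j s = + 6 * s + -1ℤ ^ j
  U j s = + 3 * (+ 3) ^ j * s - + 2 * geom (- + 3) j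

  x≡1+2V : ∀ j s → (+ 2) ^ suc (suc j) * s + (1ℤ - (- + 2) ^ suc j) / + 3 ≡ 1ℤ + + 2 * V j s
  x≡1+2V j s = trans (cong (λ t → (+ 2) ^ suc (suc j) * s + t) ([1-[-2]^k]/3≡geom (suc j)))
                     (halve ((+ 2) ^ j) s (geom (- + 2) j))
    where
    halve : ∀ P s G → + 2 * (+ 2 * P) * s + (1ℤ + - + 2 * G) ≡ 1ℤ + + 2 * (+ 2 * P * s - G)
    halve = solve-∀

  1+3V≡2^jW : ∀ j s → 1ℤ + + 3 * V j s ≡ (+ 2) ^ j * W j s
  1+3V≡2^jW j s = 1+b[aAs-G]≡A[bas+E] (+ 2) (+ 3) ((+ 2) ^ j) (-1ℤ ^ j) (geom (- + 2) j) s
    (trans (geom-closed (- + 2) j) (cong (λ t → 1ℤ - t) (^-distribʳ-* (+ 2) -1ℤ j)))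

  1+2U≡3^jW : ∀ j s → 1ℤ + + 2 * U j s ≡ (+ 3) ^ j * W j s
  1+2U≡3^jW j s = 1+b[aAs-G]≡A[bas+E] (+ 3) (+ 2) ((+ 3) ^ j) (-1ℤ ^ j) (+ 2 * geom (- + 3) j) s
    (trans (sym (*-assoc (+ 2) (+ 2) (geom (- + 3) j)))
      (trans (geom-closed (- + 3) j) (cong (λ t → 1ℤ - t) (^-distribʳ-* (+ 3) -1ℤ j))))

  y≡2+3U : ∀ j s → (+ 3) ^ suc (suc j) * s + (1ℤ - (- + 3) ^ suc j) / + 2 ≡ + 2 + + 3 * U j s
  y≡2+3U j s = trans (cong (λ t → (+ 3) ^ suc (suc j) * s + t) ([1-[-3]^k]/2≡2*geom (suc j)))
                     (regroup ((+ 3) ^ j) s (geom (- + 3) j))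
    where
    regroup : ∀ Q s G →
      + 3 * (+ 3 * Q) * s + + 2 * (1ℤ + - + 3 * G) ≡ + 2 + + 3 * (+ 3 * Q * s - + 2 * G)
    regroup = solve-∀

  record OddParameters (j : ℕ) (s : ℤ) (x : ℕ) : Set where
    field
      v w u     : ℕ
      x≡1+2v    : x ≡ 1 ℕ.+ 2 ℕ.* v
      1+3v≡2^jw : 1 ℕ.+ 3 ℕ.* v ≡ 2 ℕ.^ j ℕ.* w
      3^jw≡1+2u : 3 ℕ.^ j ℕ.* w ≡ 1 ℕ.+ 2 ℕ.* u
      2+3u≡y    : + (2 ℕ.+ 3 ℕ.* u) ≡ (+ 3) ^ suc (suc j) * s + (1ℤ - (- + 3) ^ suc j) / + 2

  odd-parameters : ∀ j s x → + x ≡ (+ 2) ^ suc (suc j) * s + (1ℤ - (- + 2) ^ suc j) / + 3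
                 → OddParameters j s x
  odd-parameters j s x eq = record
    { v = ∣ V j s ∣ ; w = ∣ W j s ∣ ; u = ∣ U j s ∣
    ; x≡1+2v = proj₂ V≥0 ; 1+3v≡2^jw = proj₂ W≥0 ; 3^jw≡1+2u = proj₂ U≥0
    ; 2+3u≡y = trans (cong (λ t → + 2 + t) (+3∣i∣≡3i (proj₁ U≥0))) (sym (y≡2+3U j s))
    }
    where
    +3∣i∣≡3i : ∀ {i} → + ∣ i ∣ ≡ i → + (3 ℕ.* ∣ i ∣) ≡ + 3 * i
    +3∣i∣≡3i {i} = trans (pos-* 3 ∣ i ∣) ∘ cong (+ 3 *_)
    V≥0 : + ∣ V j s ∣ ≡ V j s × x ≡ 1 ℕ.+ 2 ℕ.* ∣ V j s ∣
    V≥0 = +n≡1+2*i⇒i≥0 {i = V j s} (trans eq (x≡1+2V j s))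
    W≥0 : + ∣ W j s ∣ ≡ W j s × 1 ℕ.+ 3 ℕ.* ∣ V j s ∣ ≡ 2 ℕ.^ j ℕ.* ∣ W j s ∣
    W≥0 = +n≡m*i⇒i≥0 {i = W j s} (ℕ.m^n>0 2 j) (begin
      + (1 ℕ.+ 3 ℕ.* ∣ V j s ∣) ≡⟨ cong (λ t → 1ℤ + t) (+3∣i∣≡3i (proj₁ V≥0)) ⟩
      1ℤ + + 3 * V j s         ≡⟨ 1+3V≡2^jW j s ⟩
      (+ 2) ^ j * W j s        ≡⟨ cong (_* W j s) (pos-^ 2 j) ⟩
      + (2 ℕ.^ j) * W j s      ∎)
    U≥0 : + ∣ U j s ∣ ≡ U j s × 3 ℕ.^ j ℕ.* ∣ W j s ∣ ≡ 1 ℕ.+ 2 ℕ.* ∣ U j s ∣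
    U≥0 = +n≡1+2*i⇒i≥0 {i = U j s} (begin
      + (3 ℕ.^ j ℕ.* ∣ W j s ∣)  ≡⟨ pos-* (3 ℕ.^ j) ∣ W j s ∣ ⟩
      + (3 ℕ.^ j) * + ∣ W j s ∣  ≡⟨ cong₂ _*_ (pos-^ 3 j) (sym (proj₁ W≥0)) ⟨
      (+ 3) ^ j * W j s          ≡⟨ 1+2U≡3^jW j s ⟨
      1ℤ + + 2 * U j s           ∎)

  even-parameters : ∀ s x → x ≢ 0 → + x ≡ (+ 2) ^ 1 * s + (1ℤ - (- + 2) ^ 0) / + 3
                  → Σ ℕ λ t → x ≡ 2 ℕ.* suc t
                            × + (3 ℕ.* suc t) ≡ (+ 3) ^ 1 * s + (1ℤ - (- + 3) ^ 0) / + 2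
  even-parameters s x x≢0 eq
    with ∣ s ∣ | +n≡m*i⇒i≥0 {m = 2} {i = s} (ℕ.s≤s ℕ.z≤n) (trans eq (+-identityʳ _))
  ... | zero  | refl , x≡0      = ⊥-elim (x≢0 x≡0)
  ... | suc t | refl , x≡2[1+t] = t , x≡2[1+t] , trans (pos-* 3 (suc t)) (sym (+-identityʳ _))

open T₂Columns
open IntegerArithmetic
open import Data.Integer using (ℤ; +_; _+_; _-_; _*_; _^_; -_)
open import Data.Integer.DivMod using (_/_)
import Data.Nat as ℕ

proposition16 : ∀ (n : ℕ) → n ≥ 1 → ∀ (k : ℕ) (s : ℤ) (x : ℕ) → L2 n x
    → + x ≡ (+ 2) ^ suc k * s + (+ 1 - (- + 2) ^ k) / + 3
    → Σ ℕ (λ y → L2 (suc n) y × (+ y ≡ (+ 3) ^ suc k * s + (+ 1 - (- + 3) ^ k) / + 2))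
proposition16 n _ ℕ.zero s x l eq with even-parameters s x (L2⇒≢0 l) eq
... | t , refl , y≡ = 3 ℕ.* suc t , L2-even t l , y≡
proposition16 n _ (suc j) s x l eq =
  2 ℕ.+ 3 ℕ.* u , L2-odd j v w u (subst (L2 n) x≡1+2v l) 1+3v≡2^jw 3^jw≡1+2u , 2+3u≡y
  where open OddParameters (odd-parameters j s x eq)
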